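{- Let $\alpha$ be a prenaming. Then its closure $\overline{\alpha}$ is a renaming which coincides with $\alpha$ on $V\setminus(R^+(\alpha)\setminus C^+(\alpha))$ and satisfies $\mathrm{vars}(\overline{\alpha})\subseteq V^+(\alpha)$. Additionally, if $\alpha(x)\neq x$ for all $x\in C^+(\alpha)$, then $\overline{\alpha}(x)\neq x$ for all $x\in V^+(\alpha)$.
   Context: $V$ is a countably infinite set of variables. A substitution is a map from variables to terms with finite active domain $\mathrm{Dom}(\theta)=\{x:\theta(x)\neq x\}$; $\mathrm{vars}(\theta)=\mathrm{Dom}(\theta)\cup\mathrm{vars}(\theta(\mathrm{Dom}(\theta)))$. A renaming is a bijective substitution mapping variables to variables. A prenaming is a substitution $\alpha$ mapping variables to variables together with a fixed finite set $C^+(\alpha)\supseteq\mathrm{Dom}(\alpha)$ (relaxed core) on which $\alpha$ is injective; $R^+(\alpha)=\alpha(C^+(\alpha))$ and $V^+(\alpha)=C^+(\alpha)\cup R^+(\alpha)$. The closure $\overline{\alpha}$ of $\alpha$ is defined by: $\overline{\alpha}(x)=\alpha(x)$ if $x\in C^+(\alpha)$; for $x\in R^+(\alpha)\setminus C^+(\alpha)$, $\overline{\alpha}(x)=z$ where $z$ is the start of the maximal chain $z,\alpha(z),\dots,\alpha^m(z)=x$ with $z,\alpha(z),\dots,\alpha^{m-1}(z)\in C^+(\alpha)$ (i.e. $\alpha^m(z)=x$ for maximal $m$; such $z$ lies in $C^+(\alpha)\setminus R^+(\alpha)$); and $\overline{\alpha}(x)=x$ outside $C^+(\alpha)\cup R^+(\alpha)$.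 -}

module Defs where

open import Data.Nat using (ℕ; zero; suc; _≟_)
open import Data.List using (List; map; length; _++_)
open import Data.List.Membership.Propositional using (_∈_)
open import Data.List.Membership.DecPropositional _≟_ using (_∈?_)
open import Data.Maybe using (Maybe; just; nothing)
open import Data.Product using (Σ; _×_; ∃)
open import Data.Sum using (_⊎_)
open import Relation.Nullary using (¬_; yes; no)
open import Relation.Binary.PropositionalEquality using (_≡_; _≢_)
open import Function.Definitions using (Bijective)

Var : Set
Var = ℕ

Dom : (Var → Var) → Var → Set
Dom θ x = θ x ≢ x

FiniteDomain : (Var → Var) → Set
FiniteDomain θ = Σ (List Var) λ L → ∀ x → Dom θ x → x ∈ L

vars : (Var → Var) → Var → Set
vars θ x = Dom θ x ⊎ (∃ λ y → Dom θ y × θ y ≡ x)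

IsRenaming : (Var → Var) → Set
IsRenaming θ = FiniteDomain θ × Bijective _≡_ _≡_ θ

-- A prenaming: α : Var → Var with a fixed finite relaxed core C⁺ ⊇ Dom(α),
-- α injective on C⁺.
record Prenaming : Set where
  field
    fun   : Var → Var
    core  : List Var
    dom⊆core : ∀ x → Dom fun x → x ∈ core
    injOnCore : ∀ x y → x ∈ core → y ∈ core → fun x ≡ fun y → x ≡ y

open Prenaming public

R⁺ : Prenaming → List Var
R⁺ α = map (fun α) (core α)

V⁺ : Prenaming → List Var
V⁺ α = core α ++ R⁺ α

-- The (unique, by injectivity) α-predecessor of x inside a list, if any.
predIn : (Var → Var) → List Var → Var → Maybe Var
predIn f Data.List.[] x = nothing
predIn f (y Data.List.∷ ys) x with f y ≟ x
... | yes _ = just y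
... | no  _ = predIn f ys x

-- Walk backwards along α inside C⁺ (at most `fuel` steps) until no
-- C⁺-predecessor exists; this yields the start z of the maximal chain
-- z, α(z), …, α^m(z) = x with z, …, α^{m-1}(z) ∈ C⁺.
chainStart : (Var → Var) → List Var → ℕ → Var → Var
chainStart f C zero x = x
chainStart f C (suc n) x with predIn f C x
... | just y  = chainStart f C n y
... | nothing = x

-- The closure ᾱ.  Backward chains inside C⁺ have length ≤ |C⁺|,
-- so fuel |C⁺| suffices to reach the maximal chain's start.
closure : Prenaming → Var → Var
closure α x with x ∈? core α
... | yes _ = fun α x
... | no  _ with x ∈? R⁺ α
...   | yes _ = chainStart (fun α) (core α) (length (core α)) x
...   | no  _ = x

module Submission where

-- Write f^k for the k-th iterate of f and call a C-path of length k from w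
-- to x a sequence w, f w, …, f^(k-1) w of points of C with f^k w = x.
-- Everything rests on one counting principle: k pairwise distinct points of
-- the list C force k ≤ |C|.  Two families of paths are shown to consist of
-- distinct points:
--   * paths ending outside C (shift a repetition forward to land x in C), so
--     such paths have length ≤ |C|; hence walking backwards from x ∉ C with
--     fuel |C| really reaches the start of the maximal chain (no predecessor);
--   * forward orbits of a point of C without C-predecessor (cancel a
--     repetition backwards by injectivity), so such orbits leave C within |C|
--     steps; the exit point is a preimage of the start under the closure.
-- The closure acts as f on C, as "chain start" on R⁺ \ C, and as the
-- identity elsewhere; comparing these three regions gives injectivity,
-- surjectivity, agreement with f and the bounds on the support.

open import Defs
open import Data.Nat using (ℕ; zero; suc; _≟_; _+_; _∸_; _≤_; _<_; z≤n; s≤s; s<s; s≤s⁻¹)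
open import Data.Nat.Properties
  using (≤-refl; <⇒≤; <-trans; n<1+n; 1+n≰n; m≤n⇒m≤1+n; +-comm; +-monoʳ-<; m∸n+n≡m; <-cmp; m<1+n⇒m<n∨m≡n)
open import Data.Fin using (Fin; toℕ)
open import Data.Fin.Properties using (toℕ<n; toℕ-injective; injective⇒≤)
open import Data.List using (List; _∷_; length)
open import Data.List.Relation.Unary.Any using (here; there; index)
open import Data.List.Membership.Propositional using (_∈_; _∉_)
open import Data.List.Membership.Propositional.Properties using (∈-map⁺; ∈-map⁻; ∈-++⁺ˡ; ∈-++⁺ʳ; ∈-++⁻)
import Data.List.Membership.Setoid.Properties as SetoidMembership
open import Data.List.Membership.DecPropositional _≟_ using (_∈?_)
open import Data.Maybe using (just; nothing)
open import Data.Product using (Σ; _×_; _,_; proj₁; proj₂)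
open import Data.Sum using (_⊎_; inj₁; inj₂; [_,_]′)
import Data.Sum as Sum
import Data.Product as Product
open import Data.Empty using (⊥-elim)
open import Function using (id)
open import Function.Definitions using (Injective)
open import Function.Consequences.Propositional using (strictlySurjective⇒surjective)
open import Relation.Nullary using (¬_; yes; no)
open import Relation.Binary.Definitions using (tri<; tri≈; tri>)
open import Relation.Binary.PropositionalEquality
  using (_≡_; _≢_; refl; sym; trans; cong; subst; setoid; module ≡-Reasoning)

-- Pigeonhole for lists: a sequence whose first k terms are pairwise distinct
-- members of D has k ≤ |D| (send i to the position of g i in D).
distinct-members-bound : ∀ {A : Set} {D : List A} {k} (g : ℕ → A) →
  (∀ i → i < k → g i ∈ D) → (∀ {a b} → a < b → b < k → g a ≢ g b) → k ≤ length D
distinct-members-bound {A} {D} {k} g mem distinct = injective⇒≤ position-injective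
  where
  position : Fin k → Fin (length D)
  position j = index (mem (toℕ j) (toℕ<n j))

  g-injective : ∀ {a b} → a < k → b < k → g a ≡ g b → a ≡ b
  g-injective {a} {b} a<k b<k e with <-cmp a b
  ... | tri< a<b _ _ = ⊥-elim (distinct a<b b<k e)
  ... | tri≈ _ a≡b _ = a≡b
  ... | tri> _ _ b<a = ⊥-elim (distinct b<a a<k (sym e))

  position-injective : Injective _≡_ _≡_ position
  position-injective {i} {j} e = toℕ-injective (g-injective (toℕ<n i) (toℕ<n j)
    (SetoidMembership.index-injective (setoid A) (mem (toℕ i) (toℕ<n i)) (mem (toℕ j) (toℕ<n j)) e))

module Chains (f : ℕ → ℕ) (C : List ℕ)
              (injOnC : ∀ x y → x ∈ C → y ∈ C → f x ≡ f y → x ≡ y) where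

  open ≡-Reasoning

  n : ℕ
  n = length C

  iter : ℕ → ℕ → ℕ
  iter zero    z = z
  iter (suc k) z = f (iter k z)

  iter-add : ∀ a b z → iter a (iter b z) ≡ iter (a + b) z
  iter-add zero    b z = refl
  iter-add (suc a) b z = cong f (iter-add a b z)

  iter-suc : ∀ k z → iter k (f z) ≡ iter (suc k) z
  iter-suc k z = trans (iter-add k 1 z) (cong (λ t → iter t z) (+-comm k 1))

  InC : ℕ → ℕ → Set
  InC k z = ∀ i → i < k → iter i z ∈ C

  InC-snoc : ∀ {k z} → InC k z → iter k z ∈ C → InC (suc k) z
  InC-snoc {k} inC last i i<1+k with m<1+n⇒m<n∨m≡n i<1+k
  ... | inj₁ i<k  = inC i i<k
  ... | inj₂ refl = last

  Path : ℕ → ℕ → ℕ → Set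
  Path w k x = iter k w ≡ x × InC k w

  NoPred : ℕ → Set
  NoPred w = ∀ p → p ∈ C → f p ≢ w

  path-snoc : ∀ {w k y x} → Path w k y → y ∈ C → f y ≡ x → Path w (suc k) x
  path-snoc (refl , inC) y∈C fy≡x = fy≡x , InC-snoc inC y∈C

  path-cons : ∀ {w k x q} → Path w k x → q ∈ C → f q ≡ w → Path q (suc k) x
  path-cons {k = k} {x = x} {q = q} (reach , inC) q∈C refl = reach′ , inC′
    where
    reach′ : iter (suc k) q ≡ x
    reach′ = trans (sym (iter-suc k q)) reach
    inC′ : InC (suc k) q
    inC′ zero    _         = q∈C
    inC′ (suc i) (s<s i<k) = subst (_∈ C) (iter-suc i q) (inC i i<k)

  -- A repetition f^a w = f^b w (a < b) on a path ending at x ∉ C would put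
  -- x = f^(k-b+a) w, an earlier point of the path, inside C.
  path-distinct : ∀ {w k x} → x ∉ C → Path w k x → ∀ {a b} → a < b → b < k → iter a w ≢ iter b w
  path-distinct {w} {k} {x} x∉C (reach , inC) {a} {b} a<b b<k repeat =
    x∉C (subst (_∈ C) shifted (inC (k ∸ b + a) shortcut))
    where
    k∸b+b≡k : k ∸ b + b ≡ k
    k∸b+b≡k = m∸n+n≡m (<⇒≤ b<k)
    shifted : iter (k ∸ b + a) w ≡ x
    shifted = begin
      iter (k ∸ b + a) w        ≡⟨ sym (iter-add (k ∸ b) a w) ⟩
      iter (k ∸ b) (iter a w)   ≡⟨ cong (iter (k ∸ b)) repeat ⟩
      iter (k ∸ b) (iter b w)   ≡⟨ iter-add (k ∸ b) b w ⟩
      iter (k ∸ b + b) w        ≡⟨ cong (λ t → iter t w) k∸b+b≡k ⟩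
      iter k w                  ≡⟨ reach ⟩
      x                         ∎
    shortcut : k ∸ b + a < k
    shortcut = subst (k ∸ b + a <_) k∸b+b≡k (+-monoʳ-< (k ∸ b) a<b)

  path-length-bound : ∀ {w k x} → x ∉ C → Path w k x → k ≤ n
  path-length-bound x∉C path = distinct-members-bound _ (proj₂ path) (path-distinct x∉C path)

  -- On the orbit of a point without C-predecessor, a repetition can be
  -- cancelled backwards (f is injective on C) until it exhibits a predecessor.
  orbit-distinct : ∀ {y k} → NoPred y → InC k y → ∀ {a b} → a < b → b < k → iter a y ≢ iter b y
  orbit-distinct {y} noPred inC {zero} {suc b} _ b<k e =
    noPred (iter b y) (inC b (<-trans (n<1+n b) b<k)) (sym e)
  orbit-distinct {y} {k} noPred inC {suc a} {suc b} (s<s a<b) 1+b<k e =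
    orbit-distinct noPred inC a<b b<k (injOnC _ _ (inC a (<-trans a<b b<k)) (inC b b<k) e)
    where
    b<k : b < k
    b<k = <-trans (n<1+n b) 1+b<k

  first-exit : ∀ z m → InC m z ⊎ Σ ℕ λ k → k < m × InC k z × iter k z ∉ C
  first-exit z zero = inj₁ (λ _ ())
  first-exit z (suc m) with first-exit z m
  ... | inj₂ (k , k<m , inC , out) = inj₂ (k , m≤n⇒m≤1+n k<m , inC , out)
  ... | inj₁ inC with iter m z ∈? C
  ...   | yes inside = inj₁ (InC-snoc inC inside)
  ...   | no  out    = inj₂ (m , n<1+n m , inC , out)

  orbit-escapes : ∀ {y} → y ∈ C → NoPred y →
    Σ ℕ λ k → suc k ≤ n × InC (suc k) y × iter (suc k) y ∉ C
  orbit-escapes {y} y∈C noPred with first-exit y (suc n)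
  ... | inj₁ inC = ⊥-elim (1+n≰n (distinct-members-bound _ inC (orbit-distinct noPred inC)))
  ... | inj₂ (zero  , _        , _   , out) = ⊥-elim (out y∈C)
  ... | inj₂ (suc k , 1+k<1+n , inC , out) = k , s≤s⁻¹ 1+k<1+n , inC , out

  predIn-just : ∀ D x y → predIn f D x ≡ just y → y ∈ D × f y ≡ x
  predIn-just (d ∷ D) x y eq with f d ≟ x | eq
  ... | yes fd≡x | refl = here refl , fd≡x
  ... | no  _    | eq′  = Product.map₁ there (predIn-just D x y eq′)

  predIn-nothing : ∀ D x → predIn f D x ≡ nothing → ∀ p → p ∈ D → f p ≢ x
  predIn-nothing (d ∷ D) x eq p p∈D with f d ≟ x | eq | p∈D
  ... | no fd≢x | _   | here refl = fd≢x
  ... | no _    | eq′ | there p∈D = predIn-nothing D x eq′ p p∈D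

  chainStart-spec : ∀ fuel x → Σ ℕ λ k → k ≤ fuel × Path (chainStart f C fuel x) k x
                      × (k ≡ fuel ⊎ NoPred (chainStart f C fuel x))
  chainStart-spec zero x = 0 , z≤n , (refl , λ _ ()) , inj₁ refl
  chainStart-spec (suc fuel) x with predIn f C x in eq
  ... | nothing = 0 , z≤n , (refl , λ _ ()) , inj₂ (predIn-nothing C x eq)
  ... | just y with chainStart-spec fuel y | predIn-just C x y eq
  ...   | k , k≤fuel , path , stop | y∈C , fy≡x =
          suc k , s≤s k≤fuel , path-snoc path y∈C fy≡x , Sum.map₁ (cong suc) stop

  chainStart-start : ∀ {x p} → x ∉ C → p ∈ C → f p ≡ x →
    Σ ℕ λ k → Path (chainStart f C n x) (suc k) x × NoPred (chainStart f C n x)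
  chainStart-start {x} {p} x∉C p∈C fp≡x with chainStart-spec n x
  ... | k , _ , path , stop = nonempty k path noPred
    where
    z : ℕ
    z = chainStart f C n x
    exhausted : k ≡ n → NoPred z
    exhausted refl q q∈C fq≡z = 1+n≰n (path-length-bound x∉C (path-cons path q∈C fq≡z))
    noPred : NoPred z
    noPred = [ exhausted , id ]′ stop
    nonempty : ∀ k → Path z k x → NoPred z → Σ ℕ λ j → Path z (suc j) x × NoPred z
    nonempty zero    (z≡x , _) noPred = ⊥-elim (noPred p p∈C (trans fp≡x (sym z≡x)))
    nonempty (suc j) path      noPred = j , path , noPred

  chainStart-on-path : ∀ {z} → NoPred z → ∀ k fuel → k ≤ fuel → InC k z →
    chainStart f C fuel (iter k z) ≡ z
  chainStart-on-path noPred zero zero _ _ = refl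
  chainStart-on-path {z} noPred zero (suc fuel) _ _ with predIn f C z in eq
  ... | nothing = refl
  ... | just y  = ⊥-elim (noPred y (proj₁ (predIn-just C z y eq)) (proj₂ (predIn-just C z y eq)))
  chainStart-on-path {z} noPred (suc k) (suc fuel) (s≤s k≤fuel) inC
    with predIn f C (f (iter k z)) in eq
  ... | nothing = ⊥-elim (predIn-nothing C _ eq (iter k z) (inC k ≤-refl) refl)
  ... | just y  = trans (cong (chainStart f C fuel) y≡f^kz)
                        (chainStart-on-path noPred k fuel k≤fuel (λ i i<k → inC i (m≤n⇒m≤1+n i<k)))
    where
    y≡f^kz : y ≡ iter k z
    y≡f^kz = injOnC _ _ (proj₁ (predIn-just C _ y eq)) (inC k ≤-refl) (proj₂ (predIn-just C _ y eq))

  -- Every point of C without C-predecessor is the chain start of some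
  -- x ∈ R⁺ \ C (the exit point of its orbit).
  chainStart-onto : ∀ {y} → y ∈ C → NoPred y →
    Σ ℕ λ x → x ∉ C × (Σ ℕ λ p → p ∈ C × f p ≡ x) × chainStart f C n x ≡ y
  chainStart-onto {y} y∈C noPred with orbit-escapes y∈C noPred
  ... | k , 1+k≤n , inC , out =
        iter (suc k) y , out , (iter k y , inC k ≤-refl , refl) ,
        chainStart-on-path noPred (suc k) n 1+k≤n inC

module Closure (α : Prenaming) where

  open Chains (fun α) (core α) (injOnCore α)

  private
    f : ℕ → ℕ
    f = fun α
    C : List ℕ
    C = core α
    ᾱ : ℕ → ℕ
    ᾱ = closure α

  data Region (x : ℕ) : Set where
    core-point  : x ∈ C → Region x
    range-point : x ∉ C → x ∈ R⁺ α → Region x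
    outer-point : x ∉ C → x ∉ R⁺ α → Region x

  region : ∀ x → Region x
  region x with x ∈? C
  ... | yes x∈C = core-point x∈C
  ... | no  x∉C with x ∈? R⁺ α
  ...   | yes x∈R = range-point x∉C x∈R
  ...   | no  x∉R = outer-point x∉C x∉R

  closure-core : ∀ {x} → x ∈ C → ᾱ x ≡ f x
  closure-core {x} x∈C with x ∈? C
  ... | yes _   = refl
  ... | no  x∉C = ⊥-elim (x∉C x∈C)

  closure-range : ∀ {x} → x ∉ C → x ∈ R⁺ α → ᾱ x ≡ chainStart f C n x
  closure-range {x} x∉C x∈R with x ∈? C
  ... | yes x∈C = ⊥-elim (x∉C x∈C)
  ... | no  _ with x ∈? R⁺ α
  ...   | yes _   = refl
  ...   | no  x∉R = ⊥-elim (x∉R x∈R)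

  closure-outer : ∀ {x} → x ∉ C → x ∉ R⁺ α → ᾱ x ≡ x
  closure-outer {x} x∉C x∉R with x ∈? C
  ... | yes x∈C = ⊥-elim (x∉C x∈C)
  ... | no  _ with x ∈? R⁺ α
  ...   | yes x∈R = ⊥-elim (x∉R x∈R)
  ...   | no  _   = refl

  R⁺-preimage : ∀ {x} → x ∈ R⁺ α → Σ ℕ λ p → p ∈ C × f p ≡ x
  R⁺-preimage x∈R with ∈-map⁻ f x∈R
  ... | p , p∈C , x≡fp = p , p∈C , sym x≡fp

  f-in-R⁺ : ∀ {p} → p ∈ C → f p ∈ R⁺ α
  f-in-R⁺ = ∈-map⁺ f

  outside-R⁺-noPred : ∀ {x} → x ∉ R⁺ α → NoPred x
  outside-R⁺-noPred x∉R p p∈C fp≡x = x∉R (subst (_∈ R⁺ α) fp≡x (f-in-R⁺ p∈C))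

  closure-range-start : ∀ {x} → x ∉ C → x ∈ R⁺ α →
    Σ ℕ λ k → Path (ᾱ x) (suc k) x × NoPred (ᾱ x)
  closure-range-start x∉C x∈R rewrite closure-range x∉C x∈R with R⁺-preimage x∈R
  ... | p , p∈C , fp≡x = chainStart-start x∉C p∈C fp≡x

  closure-range-in-core : ∀ {x} → x ∉ C → x ∈ R⁺ α → ᾱ x ∈ C
  closure-range-in-core x∉C x∈R with closure-range-start x∉C x∈R
  ... | _ , (_ , inC) , _ = inC 0 (s≤s z≤n)

  -- Images of distinct regions never collide: ᾱ(core) = R⁺, ᾱ(R⁺ \ C) ⊆ C
  -- consists of points without predecessor, and outer points are fixed.
  core≢range : ∀ {x y} → x ∈ C → y ∉ C → y ∈ R⁺ α → ᾱ x ≢ ᾱ y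
  core≢range {x} x∈C y∉C y∈R e with closure-range-start y∉C y∈R
  ... | _ , _ , noPred = noPred x x∈C (trans (sym (closure-core x∈C)) e)

  core≢outer : ∀ {x y} → x ∈ C → y ∉ C → y ∉ R⁺ α → ᾱ x ≢ ᾱ y
  core≢outer x∈C y∉C y∉R e =
    y∉R (subst (_∈ R⁺ α) (trans (sym (closure-core x∈C)) (trans e (closure-outer y∉C y∉R))) (f-in-R⁺ x∈C))

  range≢outer : ∀ {x y} → x ∉ C → x ∈ R⁺ α → y ∉ C → y ∉ R⁺ α → ᾱ x ≢ ᾱ y
  range≢outer x∉C x∈R y∉C y∉R e =
    y∉C (subst (_∈ C) (trans e (closure-outer y∉C y∉R)) (closure-range-in-core x∉C x∈R))

  -- Two points of R⁺ \ C with the same chain start lie on one C-path from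
  -- it; a shorter one would be an interior point of the path, hence in C.
  range-injective : ∀ {x y} → x ∉ C → x ∈ R⁺ α → y ∉ C → y ∈ R⁺ α → ᾱ x ≡ ᾱ y → x ≡ y
  range-injective x∉C x∈R y∉C y∈R e
    with closure-range-start x∉C x∈R | closure-range-start y∉C y∈R
  ... | k , (reach-x , inC-x) , _ | l , (reach-y , inC-y) , _ with <-cmp k l
  ...   | tri< k<l _ _ = ⊥-elim (x∉C (subst (_∈ C) (trans (cong (iter (suc k)) (sym e)) reach-x) (inC-y (suc k) (s<s k<l))))
  ...   | tri> _ _ l<k = ⊥-elim (y∉C (subst (_∈ C) (trans (cong (iter (suc l)) e) reach-y) (inC-x (suc l) (s<s l<k))))
  ...   | tri≈ _ refl _ = trans (sym reach-x) (trans (cong (iter (suc k)) e) reach-y)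

  closure-injective : Injective _≡_ _≡_ ᾱ
  closure-injective {x} {y} e with region x | region y
  ... | core-point x∈C       | core-point y∈C       =
          injOnCore α x y x∈C y∈C (trans (sym (closure-core x∈C)) (trans e (closure-core y∈C)))
  ... | core-point x∈C       | range-point y∉C y∈R = ⊥-elim (core≢range x∈C y∉C y∈R e)
  ... | core-point x∈C       | outer-point y∉C y∉R = ⊥-elim (core≢outer x∈C y∉C y∉R e)
  ... | range-point x∉C x∈R | core-point y∈C       = ⊥-elim (core≢range y∈C x∉C x∈R (sym e))
  ... | range-point x∉C x∈R | range-point y∉C y∈R = range-injective x∉C x∈R y∉C y∈R e
  ... | range-point x∉C x∈R | outer-point y∉C y∉R = ⊥-elim (range≢outer x∉C x∈R y∉C y∉R e)
  ... | outer-point x∉C x∉R | core-point y∈C       = ⊥-elim (core≢outer y∈C x∉C x∉R (sym e))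
  ... | outer-point x∉C x∉R | range-point y∉C y∈R = ⊥-elim (range≢outer y∉C y∈R x∉C x∉R (sym e))
  ... | outer-point x∉C x∉R | outer-point y∉C y∉R =
          trans (sym (closure-outer x∉C x∉R)) (trans e (closure-outer y∉C y∉R))

  -- Preimages: R⁺ is hit from C, points of C \ R⁺ are chain starts, and
  -- everything else is fixed.
  closure-onto : ∀ y → Σ ℕ λ x → ᾱ x ≡ y
  closure-onto y with y ∈? R⁺ α
  ... | yes y∈R with R⁺-preimage y∈R
  ...   | p , p∈C , fp≡y = p , trans (closure-core p∈C) fp≡y
  closure-onto y | no y∉R with y ∈? C
  ... | no  y∉C = y , closure-outer y∉C y∉R
  ... | yes y∈C with chainStart-onto y∈C (outside-R⁺-noPred y∉R)
  ...   | x , x∉C , (p , p∈C , fp≡x) , start =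
          x , trans (closure-range x∉C (subst (_∈ R⁺ α) fp≡x (f-in-R⁺ p∈C))) start

  moved-in-V⁺ : ∀ {x} → ᾱ x ≢ x → x ∈ V⁺ α
  moved-in-V⁺ {x} moved with region x
  ... | core-point x∈C       = ∈-++⁺ˡ x∈C
  ... | range-point _ x∈R    = ∈-++⁺ʳ C x∈R
  ... | outer-point x∉C x∉R = ⊥-elim (moved (closure-outer x∉C x∉R))

  image-in-V⁺ : ∀ {x} → ᾱ x ≢ x → ᾱ x ∈ V⁺ α
  image-in-V⁺ {x} moved with region x
  ... | core-point x∈C       = ∈-++⁺ʳ C (subst (_∈ R⁺ α) (sym (closure-core x∈C)) (f-in-R⁺ x∈C))
  ... | range-point x∉C x∈R = ∈-++⁺ˡ (closure-range-in-core x∉C x∈R)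
  ... | outer-point x∉C x∉R = ⊥-elim (moved (closure-outer x∉C x∉R))

  closure-isRenaming : IsRenaming ᾱ
  closure-isRenaming = (V⁺ α , λ x → moved-in-V⁺) , closure-injective ,
                       strictlySurjective⇒surjective closure-onto

  -- Off R⁺ \ C the closure agrees with f: on C by definition, and outside
  -- C ∪ R⁺ both are the identity because Dom(f) ⊆ C.
  closure-agrees : ∀ x → ¬ (x ∈ R⁺ α × x ∉ C) → ᾱ x ≡ f x
  closure-agrees x notRange with region x
  ... | core-point x∈C       = closure-core x∈C
  ... | range-point x∉C x∈R = ⊥-elim (notRange (x∈R , x∉C))
  ... | outer-point x∉C x∉R with f x ≟ x
  ...   | yes fx≡x = trans (closure-outer x∉C x∉R) (sym fx≡x)
  ...   | no  fx≢x = ⊥-elim (x∉C (dom⊆core α x fx≢x))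

  closure-vars : ∀ x → vars ᾱ x → x ∈ V⁺ α
  closure-vars x (inj₁ moved)            = moved-in-V⁺ moved
  closure-vars x (inj₂ (y , moved , refl)) = image-in-V⁺ moved

  -- If f moves every core point, the closure moves every point of V⁺:
  -- chain starts lie in C while the points of R⁺ \ C do not.
  closure-fixpoint-free : (∀ x → x ∈ C → f x ≢ x) → ∀ x → x ∈ V⁺ α → ᾱ x ≢ x
  closure-fixpoint-free moves x x∈V with region x
  ... | core-point x∈C       = λ e → moves x x∈C (trans (sym (closure-core x∈C)) e)
  ... | range-point x∉C x∈R = λ e → x∉C (subst (_∈ C) e (closure-range-in-core x∉C x∈R))
  ... | outer-point x∉C x∉R = ⊥-elim ([ x∉C , x∉R ]′ (∈-++⁻ C x∈V))

mainTheorem3 : (α : Prenaming) →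
    IsRenaming (closure α)
    × (∀ x → ¬ (x ∈ R⁺ α × ¬ (x ∈ core α)) → closure α x ≡ fun α x)
    × (∀ x → vars (closure α) x → x ∈ V⁺ α)
    × ((∀ x → x ∈ core α → fun α x ≢ x) → ∀ x → x ∈ V⁺ α → closure α x ≢ x)
mainTheorem3 α = closure-isRenaming , closure-agrees , closure-vars , closure-fixpoint-free
  where open Closure α
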